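{- Let $n\ge1$ and for $\ell=1,\dots,n$ let $a'_\ell=\overline{a_\ell}\in\mathcal A_n^*$ be the co-mirror of $a_\ell$, ordered $a'_1<a'_2<\cdots<a'_n$. Then these words satisfy the Knuth relations in the plactic monoid $\mathcal P_n$: for $1\le p\le q<r\le n$, $a'_pa'_ra'_q\equiv_{\mathrm{knu}}a'_ra'_pa'_q$, and for $1\le p<q\le r\le n$, $a'_qa'_pa'_r\equiv_{\mathrm{knu}}a'_qa'_ra'_p$. Consequently, for all $u,v\in\mathcal A_n^*$, $u\equiv_{\mathrm{knu}}v$ implies $\overline u\equiv_{\mathrm{knu}}\overline v$.
   Context: $\mathcal A_n=\{a_1<\cdots<a_n\}$, $\mathcal A_n^*$ the free monoid. $\equiv_{\mathrm{knu}}$ is the Knuth (plactic) congruence on $\mathcal A_n^*$ generated by $xzy\equiv zxy$ for letters $x\le y<z$ and $yxz\equiv yzx$ for $x<y\le z$; $\mathcal P_n=\mathcal A_n^*/\!\equiv_{\mathrm{knu}}$ is the plactic monoid. The co-mirror of a letter is $\overline{a_\ell}=a_na_{n-1}\cdots a_{n-\ell+2}\,a_{n-\ell}\cdots a_1$ (the decreasing word of all letters except $a_{n-\ell+1}$); for a word, $\overline{a_{\ell_1}\cdots a_{\ell_m}}=\overline{a_{\ell_1}}\cdots\overline{a_{\ell_m}}$, and the co-mirror of the empty word is empty. -}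

module Defs where

open import Data.Nat using (ℕ)
open import Data.Fin using (Fin; _<_; _≤_; opposite)
open import Data.Fin.Properties using (_≟_)
open import Data.List using (List; []; _∷_; _++_; [_]; reverse; allFin; filter; concatMap)
open import Relation.Nullary using (¬?)

-- Letters of A_n: a_{k+1} is represented by k : Fin n, ordered by Fin's order.
Word : ℕ → Set
Word n = List (Fin n)

data _≡knu_ {n : ℕ} : Word n → Word n → Set where
  knu-refl  : ∀ {u} → u ≡knu u
  knu-sym   : ∀ {u v} → u ≡knu v → v ≡knu u
  knu-trans : ∀ {u v w} → u ≡knu v → v ≡knu w → u ≡knu w
  knu-ctx   : ∀ {u v} (l r : Word n) → u ≡knu v → (l ++ u ++ r) ≡knu (l ++ v ++ r)
  knu-xzy   : ∀ {x y z : Fin n} → x ≤ y → y < z →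
              (x ∷ z ∷ y ∷ []) ≡knu (z ∷ x ∷ y ∷ [])
  knu-yxz   : ∀ {x y z : Fin n} → x < y → y ≤ z →
              (y ∷ x ∷ z ∷ []) ≡knu (y ∷ z ∷ x ∷ [])

infix 4 _≡knu_

-- Co-mirror of the letter a_ℓ (ℓ = toℕ i + 1): the decreasing word
-- a_n a_{n-1} ... a_1 with the letter a_{n-ℓ+1} (index opposite i) removed.
comirrorLetter : {n : ℕ} → Fin n → Word n
comirrorLetter {n} i = filter (λ j → ¬? (j ≟ opposite i)) (reverse (allFin n))

comirror : {n : ℕ} → Word n → Word n
comirror = concatMap comirrorLetter

-- Write W for the decreasing word of all letters and W ∖ x for W with x deleted, so that the
-- co-mirror of a letter is W ∖ x for the complementary letter x. Decreasing words (columns) behave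
-- well in the plactic monoid: a column commutes with every word over its letters, and for i < j ≤ k
--   W ∖ i · W ∖ j ≡ W · W ∖ i ∖ j     and     W ∖ i ∖ k · W ∖ j ≡ W ∖ k · W ∖ i ∖ j,
-- both by sliding letters through columns until the two sides reach a common word (for the second,
-- W ∖ k lies letterwise below W ∖ j). Chaining these gives W ∖ k · W ∖ i · W ∖ j ≡ W ∖ i · W ∖ k · W ∖ j,
-- the first relation, for every column W containing i, j and k. Reversing a word and complementing
-- its letters preserves ≡knu and exchanges the two kinds of Knuth relation, so applied to the dual
-- column it yields the second relation.
module Submission where

open import Level using (0ℓ)
open import Defs
open import Data.Nat using (ℕ; s≤s)
open import Data.Nat.Properties using (<⇒≤; ≤-<-trans; <-≤-trans; ∸-monoʳ-<; ∸-monoʳ-≤)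
open import Data.Fin using (Fin; _<_; _≤_; _>_; opposite)
open import Data.Fin.Properties
  using (_≟_; ≤-refl; ≤-trans; <-irrefl; <-asym; <-trans; toℕ<n; opposite-prop; opposite-involutive)
open import Data.List using ([]; _∷_; _++_; [_]; filter; map; reverse; allFin)
open import Data.List.Properties
  using (++-assoc; ++-identityʳ; filter-++; filter-all; filter-accept; filter-reject;
         map-++; map-∘; map-cong; map-id; reverse-++; reverse-map; reverse-involutive; unfold-reverse;
         concatMap-++)
open import Data.List.Relation.Unary.Any using (here; there)
import Data.List.Relation.Unary.Any.Properties as Any
open import Data.List.Relation.Unary.All as All using (All; []; _∷_)
import Data.List.Relation.Unary.All.Properties as All
open import Data.List.Relation.Unary.AllPairs as AllPairs using (AllPairs; []; _∷_)
import Data.List.Relation.Unary.AllPairs.Properties as AllPairs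
open import Data.List.Relation.Binary.Pointwise as Pointwise using (Pointwise; []; _∷_)
open import Data.List.Membership.Propositional using (_∈_)
open import Data.List.Membership.Propositional.Properties using (∈-∃++; ∈-++⁻; ∈-filter⁻; ∈-map⁺; ∈-allFin)
open import Data.Product using (_×_; _,_; proj₁)
open import Data.Sum using (inj₁; inj₂)
open import Data.Empty using (⊥-elim)
open import Relation.Nullary using (Dec; ¬?; yes; no)
open import Relation.Binary.Bundles using (Setoid)
open import Relation.Binary.PropositionalEquality
  using (_≡_; _≢_; refl; sym; trans; cong; cong₂; subst; subst₂; ≢-sym; module ≡-Reasoning)

knu-setoid : ℕ → Setoid 0ℓ 0ℓ
knu-setoid n = record
  { Carrier       = Word n
  ; _≈_           = _≡knu_
  ; isEquivalence = record { refl = knu-refl ; sym = knu-sym ; trans = knu-trans }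
  }

module _ {n : ℕ} where

  open import Relation.Binary.Reasoning.Setoid (knu-setoid n)

  knu-prefix : ∀ {u v} (l : Word n) → u ≡knu v → l ++ u ≡knu l ++ v
  knu-prefix {u} {v} l u≡v =
    subst₂ _≡knu_ (cong (l ++_) (++-identityʳ u)) (cong (l ++_) (++-identityʳ v)) (knu-ctx l [] u≡v)

  knu-suffix : ∀ {u v} (r : Word n) → u ≡knu v → u ++ r ≡knu v ++ r
  knu-suffix r = knu-ctx [] r

  >⇒≢ : ∀ {a x : Fin n} → a > x → a ≢ x
  >⇒≢ x<a a≡x = <-irrefl (sym a≡x) x<a

  Column : Word n → Set
  Column = AllPairs _>_

  column-++⁻ˡ : ∀ A {B} → Column (A ++ B) → Column A
  column-++⁻ˡ []      _          = []
  column-++⁻ˡ (a ∷ A) (a> ∷ col) = All.++⁻ˡ A a> ∷ column-++⁻ˡ A col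

  column-++⁻ʳ : ∀ A {B} → Column (A ++ B) → Column B
  column-++⁻ʳ []      col       = col
  column-++⁻ʳ (a ∷ A) (_ ∷ col) = column-++⁻ʳ A col

  column-above : ∀ A {y B} → Column (A ++ y ∷ B) → All (_> y) A
  column-above []      _          = []
  column-above (a ∷ A) (a> ∷ col) with a>y ∷ _ ← All.++⁻ʳ A a> = a>y ∷ column-above A col

  column-drop : ∀ A {x B} → Column (A ++ x ∷ B) → Column (A ++ B)
  column-drop []      (_ ∷ col)  = col
  column-drop (a ∷ A) (a> ∷ col) = All.++⁺ (All.++⁻ˡ A a>) (All.tail (All.++⁻ʳ A a>)) ∷ column-drop A col

  column-snoc : ∀ A {x B} → Column (A ++ x ∷ B) → Column (A ++ [ x ])
  column-snoc A {x} {B} col = column-++⁻ˡ (A ++ [ x ]) (subst Column (sym (++-assoc A [ x ] B)) col)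

  ∈-column-below : ∀ A {x y B} → Column (A ++ y ∷ B) → x ∈ A ++ y ∷ B → x < y → x ∈ B
  ∈-column-below A col x∈ x<y with ∈-++⁻ A x∈
  ... | inj₁ x∈A         = ⊥-elim (<-asym x<y (All.lookup (column-above A col) x∈A))
  ... | inj₂ (here refl) = ⊥-elim (<-irrefl refl x<y)
  ... | inj₂ (there x∈B) = x∈B

  ∈-column-above : ∀ A {x y B} → Column (A ++ y ∷ B) → x ∈ A ++ y ∷ B → y < x → x ∈ A
  ∈-column-above A col x∈ y<x with ∈-++⁻ A x∈
  ... | inj₁ x∈A         = x∈A
  ... | inj₂ (here refl) = ⊥-elim (<-irrefl refl y<x)
  ... | inj₂ (there x∈B) with y> ∷ _ ← column-++⁻ʳ A col = ⊥-elim (<-asym y<x (All.lookup y> x∈B))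

  ≢? : ∀ (x y : Fin n) → Dec (y ≢ x)
  ≢? x y = ¬? (y ≟ x)

  infixl 6 _∖_
  _∖_ : Word n → Fin n → Word n
  w ∖ x = filter (≢? x) w

  column-∖ : ∀ {w} x → Column w → Column (w ∖ x)
  column-∖ x = AllPairs.filter⁺ (≢? x)

  ∈-∖⁻ : ∀ {w x y} → y ∈ w ∖ x → y ∈ w
  ∈-∖⁻ {x = x} y∈ = proj₁ (∈-filter⁻ (≢? x) y∈)

  ∖-∷-≢ : ∀ {y x} w → y ≢ x → (y ∷ w) ∖ x ≡ y ∷ w ∖ x
  ∖-∷-≢ {x = x} w = filter-accept (≢? x)

  ∖-fresh : ∀ {w x} → All (_≢ x) w → w ∖ x ≡ w
  ∖-fresh {x = x} = filter-all (≢? x)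

  ∖-head : ∀ {x w} → Column (x ∷ w) → (x ∷ w) ∖ x ≡ w
  ∖-head {x} (x> ∷ _) =
    trans (filter-reject (≢? x) (λ x≢x → x≢x refl)) (∖-fresh (All.map (λ x>y → ≢-sym (>⇒≢ x>y)) x>))

  ∖-above : ∀ {x} A B → All (_> x) A → (A ++ B) ∖ x ≡ A ++ B ∖ x
  ∖-above {x} A B A>x = trans (filter-++ (≢? x) A B) (cong (_++ B ∖ x) (∖-fresh (All.map >⇒≢ A>x)))

  ∖-below : ∀ {x} A B → All (x >_) B → (A ++ B) ∖ x ≡ A ∖ x ++ B
  ∖-below {x} A B x>B =
    trans (filter-++ (≢? x) A B) (cong (A ∖ x ++_) (∖-fresh (All.map (λ x>b → ≢-sym (>⇒≢ x>b)) x>B)))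

  ∖-pivot : ∀ A {x B} → Column (A ++ x ∷ B) → (A ++ x ∷ B) ∖ x ≡ A ++ B
  ∖-pivot A {x} {B} col =
    trans (∖-above A (x ∷ B) (column-above A col)) (cong (A ++_) (∖-head (column-++⁻ʳ A col)))

  ∖-shift : ∀ {u U j} → Column (u ∷ U) → j ∈ U → Pointwise _≤_ U (u ∷ U ∖ j)
  ∖-shift {U = v ∷ V} ((u>v ∷ _) ∷ colV) (here refl) rewrite ∖-head colV = <⇒≤ u>v ∷ Pointwise.refl ≤-refl
  ∖-shift {U = v ∷ V} ((u>v ∷ _) ∷ colV@(v>V ∷ _)) (there j∈V)
    rewrite ∖-∷-≢ V (>⇒≢ (All.lookup v>V j∈V)) = <⇒≤ u>v ∷ ∖-shift colV j∈V

  ∖-antitone : ∀ {U j k} → Column U → j ∈ U → k ∈ U → j ≤ k → Pointwise _≤_ (U ∖ k) (U ∖ j)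
  ∖-antitone _ (here refl) (here refl) _ = Pointwise.refl ≤-refl
  ∖-antitone {u ∷ U} col@(u>U ∷ _) (there j∈U) (here refl) _
    rewrite ∖-head col | ∖-∷-≢ U (>⇒≢ (All.lookup u>U j∈U)) = ∖-shift col j∈U
  ∖-antitone (u>U ∷ _) (here refl) (there k∈U) j≤k =
    ⊥-elim (<-irrefl refl (≤-<-trans j≤k (All.lookup u>U k∈U)))
  ∖-antitone {u ∷ U} (u>U ∷ colU) (there j∈U) (there k∈U) j≤k
    rewrite ∖-∷-≢ U (>⇒≢ (All.lookup u>U j∈U)) | ∖-∷-≢ U (>⇒≢ (All.lookup u>U k∈U))
    = ≤-refl ∷ ∖-antitone colU j∈U k∈U j≤k

  slideˡ : ∀ {y z} c r → Column (y ∷ c) → y ≤ z → y ∷ c ++ z ∷ r ≡knu y ∷ z ∷ c ++ r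
  slideˡ []             r _                 _   = knu-refl
  slideˡ {y} {z} (c ∷ cs) r ((c<y ∷ _) ∷ col) y≤z = begin
    y ∷ c ∷ cs ++ z ∷ r   ≈⟨ knu-prefix [ y ] (slideˡ cs r col (≤-trans (<⇒≤ c<y) y≤z)) ⟩
    y ∷ c ∷ z ∷ cs ++ r   ≈⟨ knu-suffix (cs ++ r) (knu-yxz c<y y≤z) ⟩
    y ∷ z ∷ c ∷ cs ++ r   ∎

  slideʳ : ∀ {x y} c r → Column c → All (_> y) c → x ≤ y → x ∷ c ++ y ∷ r ≡knu c ++ x ∷ y ∷ r
  slideʳ []                   r _                 _               _   = knu-refl
  slideʳ (c ∷ [])             r _                 (c>y ∷ [])      x≤y = knu-suffix r (knu-xzy x≤y c>y)
  slideʳ {x} {y} (c ∷ d ∷ cs) r ((d<c ∷ _) ∷ col) (_ ∷ d>y ∷ cs>y) x≤y = begin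
    x ∷ c ∷ d ∷ cs ++ y ∷ r   ≈⟨ knu-suffix (cs ++ y ∷ r) (knu-xzy (≤-trans x≤y (<⇒≤ d>y)) d<c) ⟩
    c ∷ x ∷ d ∷ cs ++ y ∷ r   ≈⟨ knu-prefix [ c ] (slideʳ (d ∷ cs) r col (d>y ∷ cs>y) x≤y) ⟩
    c ∷ d ∷ cs ++ x ∷ y ∷ r   ∎

  column-central-letter : ∀ {W x} r → Column W → x ∈ W → W ++ x ∷ r ≡knu x ∷ W ++ r
  column-central-letter {x = x} r col x∈W with U , L , refl ← ∈-∃++ x∈W = begin
    (U ++ x ∷ L) ++ x ∷ r   ≡⟨ ++-assoc U (x ∷ L) (x ∷ r) ⟩
    U ++ x ∷ L ++ x ∷ r     ≈⟨ knu-prefix U (slideˡ L r (column-++⁻ʳ U col) ≤-refl) ⟩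
    U ++ x ∷ x ∷ L ++ r     ≈⟨ slideʳ U (L ++ r) (column-++⁻ˡ U col) (column-above U col) ≤-refl ⟨
    x ∷ U ++ x ∷ L ++ r     ≡⟨ cong (x ∷_) (++-assoc U (x ∷ L) r) ⟨
    x ∷ (U ++ x ∷ L) ++ r   ∎

  column-central : ∀ {W w} → Column W → All (_∈ W) w → w ++ W ≡knu W ++ w
  column-central {W} col []                      = begin W ≡⟨ ++-identityʳ W ⟨ W ++ [] ∎
  column-central {W} col (_∷_ {x} {w} x∈W w⊆W) = begin
    x ∷ w ++ W   ≈⟨ knu-prefix [ x ] (column-central col w⊆W) ⟩
    x ∷ W ++ w   ≈⟨ column-central-letter w col x∈W ⟨
    W ++ x ∷ w   ∎

  doubled : Word n → Word n
  doubled []      = []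
  doubled (x ∷ w) = x ∷ x ∷ doubled w

  peel-top : ∀ T X Y → Column (T ++ X) → T ++ X ++ T ++ Y ≡knu doubled T ++ X ++ Y
  peel-top []      X Y _              = knu-refl
  peel-top (t ∷ T) X Y col@(_ ∷ col′) = begin
    t ∷ T ++ X ++ t ∷ T ++ Y      ≡⟨ cong (t ∷_) (++-assoc T X (t ∷ T ++ Y)) ⟨
    t ∷ (T ++ X) ++ t ∷ T ++ Y    ≈⟨ slideˡ (T ++ X) (T ++ Y) col ≤-refl ⟩
    t ∷ t ∷ (T ++ X) ++ T ++ Y    ≡⟨ cong (λ w → t ∷ t ∷ w) (++-assoc T X (T ++ Y)) ⟩
    t ∷ t ∷ T ++ X ++ T ++ Y      ≈⟨ knu-prefix (t ∷ t ∷ []) (peel-top T X Y col′) ⟩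
    t ∷ t ∷ doubled T ++ X ++ Y   ∎

  peel-bottom : ∀ Y L → Column (Y ++ L) → L ++ Y ++ L ≡knu Y ++ doubled L
  peel-bottom Y []      _   = knu-refl
  peel-bottom Y (l ∷ L) col = begin
    l ∷ L ++ Y ++ l ∷ L             ≡⟨ cong (λ w → l ∷ L ++ w) (++-assoc Y [ l ] L) ⟨
    l ∷ L ++ (Y ++ [ l ]) ++ L      ≈⟨ knu-prefix [ l ] (peel-bottom (Y ++ [ l ]) L col′) ⟩
    l ∷ (Y ++ [ l ]) ++ doubled L   ≡⟨ cong (l ∷_) (++-assoc Y [ l ] (doubled L)) ⟩
    l ∷ Y ++ l ∷ doubled L          ≈⟨ slideʳ Y (doubled L) (column-++⁻ˡ Y col) (column-above Y col) ≤-refl ⟩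
    Y ++ l ∷ l ∷ doubled L          ∎
    where
    col′ : Column ((Y ++ [ l ]) ++ L)
    col′ = subst Column (sym (++-assoc Y [ l ] L)) col

  slide-pointwise : ∀ X Y β r → Pointwise _≤_ X Y → Column (X ++ [ β ]) →
                    X ++ β ∷ Y ++ r ≡knu X ++ Y ++ β ∷ r
  slide-pointwise []      []      β r []          _              = knu-refl
  slide-pointwise (x ∷ X) (y ∷ Y) β r (x≤y ∷ X≤Y) col@(_ ∷ col′) = begin
    x ∷ X ++ β ∷ y ∷ Y ++ r          ≡⟨ cong (x ∷_) (++-assoc X [ β ] (y ∷ Y ++ r)) ⟨
    x ∷ (X ++ [ β ]) ++ y ∷ Y ++ r   ≈⟨ slideˡ (X ++ [ β ]) (Y ++ r) col x≤y ⟩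
    x ∷ y ∷ (X ++ [ β ]) ++ Y ++ r   ≡⟨ cong (λ w → x ∷ y ∷ w) (++-assoc X [ β ] (Y ++ r)) ⟩
    x ∷ y ∷ X ++ β ∷ Y ++ r          ≈⟨ knu-prefix (x ∷ y ∷ []) (slide-pointwise X Y β r X≤Y col′) ⟩
    x ∷ y ∷ X ++ Y ++ β ∷ r          ≈⟨ slideˡ X (Y ++ β ∷ r) (column-++⁻ˡ (x ∷ X) col) x≤y ⟨
    x ∷ X ++ y ∷ Y ++ β ∷ r          ∎

  merge-decomposed : ∀ T y S x L → Column (T ++ y ∷ S ++ x ∷ L) →
                     (T ++ y ∷ S ++ L) ++ T ++ S ++ x ∷ L ≡knu (T ++ y ∷ S ++ x ∷ L) ++ T ++ S ++ L
  merge-decomposed T y S x L col = begin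
    (T ++ y ∷ S ++ L) ++ T ++ S ++ x ∷ L          ≡⟨ ++-assoc T (y ∷ S ++ L) (T ++ S ++ x ∷ L) ⟩
    T ++ (y ∷ S ++ L) ++ T ++ S ++ x ∷ L          ≈⟨ peel-top T (y ∷ S ++ L) (S ++ x ∷ L) colT-S-L ⟩
    doubled T ++ (y ∷ S ++ L) ++ S ++ x ∷ L       ≡⟨ cong (λ w → doubled T ++ y ∷ w) reassoc ⟩
    doubled T ++ y ∷ S ++ L ++ (S ++ [ x ]) ++ L
      ≈⟨ knu-prefix (doubled T) (knu-prefix (y ∷ S) (peel-bottom (S ++ [ x ]) L colSx-L)) ⟩
    doubled T ++ y ∷ S ++ (S ++ [ x ]) ++ doubled L
      ≡⟨ cong (λ w → doubled T ++ y ∷ S ++ w) (++-assoc S [ x ] (doubled L)) ⟩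
    doubled T ++ y ∷ S ++ S ++ x ∷ doubled L
      ≈⟨ knu-prefix (doubled T) (knu-prefix [ y ]
           (slide-pointwise S S x (doubled L) (Pointwise.refl ≤-refl) (column-snoc S colSxL))) ⟨
    doubled T ++ y ∷ S ++ x ∷ S ++ doubled L
      ≈⟨ knu-prefix (doubled T) (knu-prefix (y ∷ S) (knu-prefix [ x ]
           (peel-bottom S L (column-drop S colSxL)))) ⟨
    doubled T ++ y ∷ S ++ x ∷ L ++ S ++ L
      ≡⟨ cong (λ w → doubled T ++ y ∷ w) (++-assoc S (x ∷ L) (S ++ L)) ⟨
    doubled T ++ (y ∷ S ++ x ∷ L) ++ S ++ L       ≈⟨ peel-top T (y ∷ S ++ x ∷ L) (S ++ L) col ⟨
    T ++ (y ∷ S ++ x ∷ L) ++ T ++ S ++ L          ≡⟨ ++-assoc T (y ∷ S ++ x ∷ L) (T ++ S ++ L) ⟨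
    (T ++ y ∷ S ++ x ∷ L) ++ T ++ S ++ L          ∎
    where
    colSxL : Column (S ++ x ∷ L)
    colSxL with _ ∷ c ← column-++⁻ʳ T col = c
    colSx-L : Column ((S ++ [ x ]) ++ L)
    colSx-L = subst Column (sym (++-assoc S [ x ] L)) colSxL
    colT-S-L : Column (T ++ y ∷ S ++ L)
    colT-S-L = subst Column (++-assoc T (y ∷ S) L)
                 (column-drop (T ++ y ∷ S) (subst Column (sym (++-assoc T (y ∷ S) (x ∷ L))) col))
    reassoc : (S ++ L) ++ S ++ x ∷ L ≡ S ++ L ++ (S ++ [ x ]) ++ L
    reassoc = trans (++-assoc S L (S ++ x ∷ L)) (cong (λ v → S ++ L ++ v) (sym (++-assoc S [ x ] L)))

  exchange-decomposed : ∀ X Y β L → Pointwise _≤_ X Y → Column (X ++ β ∷ L) → Column (Y ++ β ∷ L) →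
                        (X ++ L) ++ Y ++ β ∷ L ≡knu (X ++ β ∷ L) ++ Y ++ L
  exchange-decomposed X Y β L X≤Y colX colY = begin
    (X ++ L) ++ Y ++ β ∷ L           ≡⟨ ++-assoc X L (Y ++ β ∷ L) ⟩
    X ++ L ++ Y ++ β ∷ L             ≡⟨ cong (λ w → X ++ L ++ w) (++-assoc Y [ β ] L) ⟨
    X ++ L ++ (Y ++ [ β ]) ++ L
      ≈⟨ knu-prefix X (peel-bottom (Y ++ [ β ]) L (subst Column (sym (++-assoc Y [ β ] L)) colY)) ⟩
    X ++ (Y ++ [ β ]) ++ doubled L   ≡⟨ cong (X ++_) (++-assoc Y [ β ] (doubled L)) ⟩
    X ++ Y ++ β ∷ doubled L          ≈⟨ slide-pointwise X Y β (doubled L) X≤Y (column-snoc X colX) ⟨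
    X ++ β ∷ Y ++ doubled L
      ≈⟨ knu-prefix X (knu-prefix [ β ] (peel-bottom Y L (column-drop Y colY))) ⟨
    X ++ β ∷ L ++ Y ++ L             ≡⟨ ++-assoc X (β ∷ L) (Y ++ L) ⟨
    (X ++ β ∷ L) ++ Y ++ L           ∎

  deletions-merge : ∀ {W x y} → Column W → x ∈ W → y ∈ W → x < y →
                    W ∖ x ++ W ∖ y ≡knu W ++ W ∖ x ∖ y
  deletions-merge {x = x} {y} col x∈W y∈W x<y
    with T , _ , refl ← ∈-∃++ y∈W
    with S , L , refl ← ∈-∃++ (∈-column-below T col x∈W x<y) = begin
      W ∖ x ++ W ∖ y                         ≡⟨ cong₂ _++_ W∖x (∖-pivot T col) ⟩
      (T ++ y ∷ S ++ L) ++ T ++ S ++ x ∷ L   ≈⟨ merge-decomposed T y S x L col ⟩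
      W ++ T ++ S ++ L                       ≡⟨ cong (W ++_) W∖x∖y ⟨
      W ++ W ∖ x ∖ y                         ∎
    where
    W = T ++ y ∷ S ++ x ∷ L
    W∖x : W ∖ x ≡ T ++ y ∷ S ++ L
    W∖x with _ ∷ colSxL ← column-++⁻ʳ T col =
      trans (∖-above T (y ∷ S ++ x ∷ L) (All.map (<-trans x<y) (column-above T col)))
            (cong (T ++_) (trans (∖-∷-≢ (S ++ x ∷ L) (>⇒≢ x<y)) (cong (y ∷_) (∖-pivot S colSxL))))
    W∖x∖y : W ∖ x ∖ y ≡ T ++ S ++ L
    W∖x∖y = trans (cong (_∖ y) W∖x) (∖-pivot T (subst Column W∖x (column-∖ x col)))

  deletions-exchange : ∀ {W i j k} → Column W → i ∈ W → j ∈ W → k ∈ W → i < j → j ≤ k →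
                       W ∖ i ∖ k ++ W ∖ j ≡knu W ∖ k ++ W ∖ i ∖ j
  deletions-exchange {i = i} {j} {k} col i∈W j∈W k∈W i<j j≤k with U , L , refl ← ∈-∃++ i∈W = begin
    W ∖ i ∖ k ++ W ∖ j               ≡⟨ cong₂ _++_ (W∖i∖ i<k) (W∖ i<j) ⟩
    (U ∖ k ++ L) ++ U ∖ j ++ i ∷ L
      ≈⟨ exchange-decomposed (U ∖ k) (U ∖ j) i L U∖k≤U∖j (column-W∖ i<k) (column-W∖ i<j) ⟩
    (U ∖ k ++ i ∷ L) ++ U ∖ j ++ L   ≡⟨ cong₂ _++_ (W∖ i<k) (W∖i∖ i<j) ⟨
    W ∖ k ++ W ∖ i ∖ j               ∎
    where
    W = U ++ i ∷ L
    i<k = <-≤-trans i<j j≤k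
    below : ∀ {z} → i < z → All (z >_) (i ∷ L)
    below i<z with i>L ∷ _ ← column-++⁻ʳ U col = i<z ∷ All.map (λ l<i → <-trans l<i i<z) i>L
    W∖ : ∀ {z} → i < z → W ∖ z ≡ U ∖ z ++ i ∷ L
    W∖ i<z = ∖-below U (i ∷ L) (below i<z)
    W∖i∖ : ∀ {z} → i < z → W ∖ i ∖ z ≡ U ∖ z ++ L
    W∖i∖ i<z = trans (cong (_∖ _) (∖-pivot U col)) (∖-below U L (All.tail (below i<z)))
    column-W∖ : ∀ {z} → i < z → Column (U ∖ z ++ i ∷ L)
    column-W∖ {z} i<z = subst Column (W∖ i<z) (column-∖ z col)
    U∖k≤U∖j : Pointwise _≤_ (U ∖ k) (U ∖ j)
    U∖k≤U∖j =
      ∖-antitone (column-++⁻ˡ U col) (∈-column-above U col j∈W i<j) (∈-column-above U col k∈W i<k) j≤k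

  deletions-knuth : ∀ {W i j k} → Column W → i ∈ W → j ∈ W → k ∈ W → i < j → j ≤ k →
                    W ∖ k ++ W ∖ i ++ W ∖ j ≡knu W ∖ i ++ W ∖ k ++ W ∖ j
  deletions-knuth {W} {i} {j} {k} col i∈W j∈W k∈W i<j j≤k = begin
    W ∖ k ++ W ∖ i ++ W ∖ j     ≈⟨ knu-prefix (W ∖ k) (deletions-merge col i∈W j∈W i<j) ⟩
    W ∖ k ++ W ++ W ∖ i ∖ j     ≡⟨ ++-assoc (W ∖ k) W (W ∖ i ∖ j) ⟨
    (W ∖ k ++ W) ++ W ∖ i ∖ j   ≈⟨ knu-suffix (W ∖ i ∖ j) (column-central col (All.tabulate ∈-∖⁻)) ⟩
    (W ++ W ∖ k) ++ W ∖ i ∖ j   ≡⟨ ++-assoc W (W ∖ k) (W ∖ i ∖ j) ⟩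
    W ++ W ∖ k ++ W ∖ i ∖ j     ≈⟨ knu-prefix W (deletions-exchange col i∈W j∈W k∈W i<j j≤k) ⟨
    W ++ W ∖ i ∖ k ++ W ∖ j     ≡⟨ ++-assoc W (W ∖ i ∖ k) (W ∖ j) ⟨
    (W ++ W ∖ i ∖ k) ++ W ∖ j   ≈⟨ knu-suffix (W ∖ j) (deletions-merge col i∈W k∈W i<k) ⟨
    (W ∖ i ++ W ∖ k) ++ W ∖ j   ≡⟨ ++-assoc (W ∖ i) (W ∖ k) (W ∖ j) ⟩
    W ∖ i ++ W ∖ k ++ W ∖ j     ∎
    where
    i<k = <-≤-trans i<j j≤k

module _ {n : ℕ} where

  open ≡-Reasoning

  opposite-< : ∀ {i j : Fin n} → i < j → opposite j < opposite i
  opposite-< {i} {j} i<j rewrite opposite-prop i | opposite-prop j = ∸-monoʳ-< (s≤s i<j) (toℕ<n j)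

  opposite-≤ : ∀ {i j : Fin n} → i ≤ j → opposite j ≤ opposite i
  opposite-≤ {i} {j} i≤j rewrite opposite-prop i | opposite-prop j = ∸-monoʳ-≤ n (s≤s i≤j)

  reverse-increasing : ∀ {w : Word n} → AllPairs _<_ w → Column (reverse w)
  reverse-increasing []                 = []
  reverse-increasing {x ∷ w} (x< ∷ inc) =
    subst Column (sym (unfold-reverse x w)) (AllPairs.++⁺ (reverse-increasing inc) ([] ∷ []) above-x)
    where
    above-x : All (λ y → All (y >_) [ x ]) (reverse w)
    above-x = All.tabulate (λ y∈ → All.lookup x< (Any.reverse⁻ y∈) ∷ [])

  full-column : Column (reverse (allFin n))
  full-column = reverse-increasing (AllPairs.tabulate⁺-< (λ i<j → i<j))

  ∈-full-column : ∀ x → x ∈ reverse (allFin n)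
  ∈-full-column x = Any.reverse⁺ (∈-allFin x)

  dual : Word n → Word n
  dual w = reverse (map opposite w)

  dual-++ : ∀ u v → dual (u ++ v) ≡ dual v ++ dual u
  dual-++ u v = trans (cong reverse (map-++ opposite u v)) (reverse-++ (map opposite u) (map opposite v))

  dual-++₃ : ∀ u v w → dual (u ++ v ++ w) ≡ dual w ++ dual v ++ dual u
  dual-++₃ u v w = begin
    dual (u ++ v ++ w)             ≡⟨ dual-++ u (v ++ w) ⟩
    dual (v ++ w) ++ dual u        ≡⟨ cong (_++ dual u) (dual-++ v w) ⟩
    (dual w ++ dual v) ++ dual u   ≡⟨ ++-assoc (dual w) (dual v) (dual u) ⟩
    dual w ++ dual v ++ dual u     ∎

  dual-involutive : ∀ w → dual (dual w) ≡ w
  dual-involutive w = begin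
    reverse (map opposite (reverse (map opposite w)))  ≡⟨ cong reverse (reverse-map opposite (map opposite w)) ⟩
    reverse (reverse (map opposite (map opposite w)))  ≡⟨ reverse-involutive _ ⟩
    map opposite (map opposite w)                      ≡⟨ map-∘ w ⟨
    map (λ x → opposite (opposite x)) w                ≡⟨ map-cong opposite-involutive w ⟩
    map (λ x → x) w                                    ≡⟨ map-id w ⟩
    w                                                  ∎

  dual-resp-≡knu : ∀ {u v : Word n} → u ≡knu v → dual u ≡knu dual v
  dual-resp-≡knu knu-refl                = knu-refl
  dual-resp-≡knu (knu-sym p)             = knu-sym (dual-resp-≡knu p)
  dual-resp-≡knu (knu-trans p q)         = knu-trans (dual-resp-≡knu p) (dual-resp-≡knu q)
  dual-resp-≡knu (knu-ctx {u} {v} l r p) =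
    subst₂ _≡knu_ (sym (dual-++₃ l u r)) (sym (dual-++₃ l v r)) (knu-ctx (dual r) (dual l) (dual-resp-≡knu p))
  dual-resp-≡knu (knu-xzy x≤y y<z)       = knu-yxz (opposite-< y<z) (opposite-≤ x≤y)
  dual-resp-≡knu (knu-yxz x<y y≤z)       = knu-xzy (opposite-≤ y≤z) (opposite-< x<y)

  column-dual : ∀ {w} → Column w → Column (dual w)
  column-dual col = reverse-increasing (AllPairs.map⁺ (AllPairs.map opposite-< col))

  dual-∖ : ∀ w x → dual (w ∖ x) ≡ dual w ∖ opposite x
  dual-∖ []      x = refl
  dual-∖ (y ∷ w) x with y ≟ x
  ... | yes refl = begin
    dual (w ∖ y)                                          ≡⟨ dual-∖ w y ⟩
    dual w ∖ opposite y                                   ≡⟨ ++-identityʳ _ ⟨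
    dual w ∖ opposite y ++ []
      ≡⟨ cong (dual w ∖ opposite y ++_) (∖-head {x = opposite y} ([] ∷ [])) ⟨
    dual w ∖ opposite y ++ [ opposite y ] ∖ opposite y    ≡⟨ filter-++ _ (dual w) [ opposite y ] ⟨
    (dual w ++ [ opposite y ]) ∖ opposite y               ≡⟨ cong (_∖ opposite y) (dual-++ [ y ] w) ⟨
    dual (y ∷ w) ∖ opposite y                             ∎
  ... | no y≢x = begin
    dual (y ∷ w ∖ x)                                      ≡⟨ dual-++ [ y ] (w ∖ x) ⟩
    dual (w ∖ x) ++ [ opposite y ]                        ≡⟨ cong (_++ [ opposite y ]) (dual-∖ w x) ⟩
    dual w ∖ opposite x ++ [ opposite y ]                 ≡⟨ cong (dual w ∖ opposite x ++_) (∖-∷-≢ [] ȳ≢x̄) ⟨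
    dual w ∖ opposite x ++ [ opposite y ] ∖ opposite x    ≡⟨ filter-++ _ (dual w) [ opposite y ] ⟨
    (dual w ++ [ opposite y ]) ∖ opposite x               ≡⟨ cong (_∖ opposite x) (dual-++ [ y ] w) ⟨
    dual (y ∷ w) ∖ opposite x                             ∎
    where
    ȳ≢x̄ : opposite y ≢ opposite x
    ȳ≢x̄ ȳ≡x̄ =
      y≢x (trans (sym (opposite-involutive y)) (trans (cong opposite ȳ≡x̄) (opposite-involutive x)))

  comirrorLetter-knuth-xzy : (p q r : Fin n) → p ≤ q → q < r →
    comirrorLetter p ++ comirrorLetter r ++ comirrorLetter q
      ≡knu comirrorLetter r ++ comirrorLetter p ++ comirrorLetter q
  comirrorLetter-knuth-xzy p q r p≤q q<r =
    deletions-knuth full-column (∈-full-column _) (∈-full-column _) (∈-full-column _)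
      (opposite-< q<r) (opposite-≤ p≤q)

  comirrorLetter-knuth-yxz : (p q r : Fin n) → p < q → q ≤ r →
    comirrorLetter q ++ comirrorLetter p ++ comirrorLetter r
      ≡knu comirrorLetter q ++ comirrorLetter r ++ comirrorLetter p
  comirrorLetter-knuth-yxz p q r p<q q≤r =
    subst₂ _≡knu_ (dual-deletions r p q) (dual-deletions p r q)
      (dual-resp-≡knu (deletions-knuth (column-dual full-column) (∈-W′ p) (∈-W′ q) (∈-W′ r) p<q q≤r))
    where
    W′ = dual (reverse (allFin n))
    ∈-W′ : ∀ x → x ∈ W′
    ∈-W′ x = subst (_∈ W′) (opposite-involutive x)
               (Any.reverse⁺ (∈-map⁺ opposite (∈-full-column (opposite x))))
    dual-deletion : ∀ x → dual (W′ ∖ x) ≡ comirrorLetter x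
    dual-deletion x = trans (dual-∖ W′ x) (cong (_∖ opposite x) (dual-involutive (reverse (allFin n))))
    dual-deletions : ∀ x y z →
      dual (W′ ∖ x ++ W′ ∖ y ++ W′ ∖ z) ≡ comirrorLetter z ++ comirrorLetter y ++ comirrorLetter x
    dual-deletions x y z = trans (dual-++₃ (W′ ∖ x) (W′ ∖ y) (W′ ∖ z))
      (cong₂ _++_ (dual-deletion z) (cong₂ _++_ (dual-deletion y) (dual-deletion x)))

  comirror-++₃ : ∀ (u v w : Word n) → comirror (u ++ v ++ w) ≡ comirror u ++ comirror v ++ comirror w
  comirror-++₃ u v w =
    trans (concatMap-++ comirrorLetter u (v ++ w)) (cong (comirror u ++_) (concatMap-++ comirrorLetter v w))

  comirror-letters₃ : ∀ (a b c : Fin n) →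
    comirror (a ∷ b ∷ c ∷ []) ≡ comirrorLetter a ++ comirrorLetter b ++ comirrorLetter c
  comirror-letters₃ a b c =
    cong (λ w → comirrorLetter a ++ comirrorLetter b ++ w) (++-identityʳ (comirrorLetter c))

  comirror-resp-≡knu : ∀ {u v : Word n} → u ≡knu v → comirror u ≡knu comirror v
  comirror-resp-≡knu knu-refl                = knu-refl
  comirror-resp-≡knu (knu-sym p)             = knu-sym (comirror-resp-≡knu p)
  comirror-resp-≡knu (knu-trans p q)         = knu-trans (comirror-resp-≡knu p) (comirror-resp-≡knu q)
  comirror-resp-≡knu (knu-ctx {u} {v} l r p) =
    subst₂ _≡knu_ (sym (comirror-++₃ l u r)) (sym (comirror-++₃ l v r))
      (knu-ctx (comirror l) (comirror r) (comirror-resp-≡knu p))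
  comirror-resp-≡knu (knu-xzy {x} {y} {z} x≤y y<z) =
    subst₂ _≡knu_ (sym (comirror-letters₃ x z y)) (sym (comirror-letters₃ z x y))
      (comirrorLetter-knuth-xzy x y z x≤y y<z)
  comirror-resp-≡knu (knu-yxz {x} {y} {z} x<y y≤z) =
    subst₂ _≡knu_ (sym (comirror-letters₃ y x z)) (sym (comirror-letters₃ y z x))
      (comirrorLetter-knuth-yxz x y z x<y y≤z)

theorem7p2 : (n : ℕ) →
    ((p q r : Fin n) → p ≤ q → q < r →
      (comirrorLetter p ++ comirrorLetter r ++ comirrorLetter q)
        ≡knu (comirrorLetter r ++ comirrorLetter p ++ comirrorLetter q))
    × ((p q r : Fin n) → p < q → q ≤ r →
      (comirrorLetter q ++ comirrorLetter p ++ comirrorLetter r)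
        ≡knu (comirrorLetter q ++ comirrorLetter r ++ comirrorLetter p))
    × ((u v : Word n) → u ≡knu v → comirror u ≡knu comirror v)
theorem7p2 n = comirrorLetter-knuth-xzy , comirrorLetter-knuth-yxz , λ _ _ → comirror-resp-≡knu
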